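{- Let $\mu$ be the Thue–Morse morphism $\mu(0)=01$, $\mu(1)=10$, let $\mathcal{L}$ be the set of all factors of words in $\mu(\{0,1\}^*)$, and let $\delta$ denote the operator deleting the first (leftmost) letter of a nonempty word. Let $\alpha > 2$ be real and $r = \lceil \alpha \rceil$. Let $s, t$ be positive integers with $s \geq 3$ such that there are words $x, y \in \{0,1\}^*$ with $\mu^s(0) = x00y$ and $|x| = t$. Suppose that $2 < r - t/2^s < \alpha$, and let $v \in \{0,1\}^*$ be such that $00v \in \mathcal{L}$ and $00v$ is $\alpha$ power-free. Then: (1) the word $\delta^t \mu^s(0^r v)$ has a prefix which is a $\beta$ power, where $\beta = r - t/2^s$; (2) if $00v$ contains a $\gamma$ power of period $p$ (for some $\gamma$ and some positive integer $p$), then $\delta^t \mu^s(0^r v)$ contains a $\gamma$ power of period $2^s p$; (3) the word $\delta^t \mu^s(0^r v)$ is $\alpha$ power-free.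
   Context: For a rational number $\beta$, a word $w$ is a $\beta$ power if there exist words $x, x'$ and a positive integer $n$, with $x'$ a prefix of $x$, such that $w = x^n x'$ and $\beta = n + |x'|/|x|$; $|x|$ is a period of $w$. A word contains a $\beta$ power if some subword of it is a $\beta$ power. A word is $\alpha$ power-free if none of its subwords is a $\beta$ power with $\beta \ge \alpha$. $\delta^t$ denotes $t$-fold application of $\delta$. -}

module Defs where

open import Data.Bool using (Bool; true; false)
open import Data.List using (List; []; _∷_; _++_; concatMap; concat; replicate; length; drop)
open import Data.Nat using (ℕ; zero; suc; _^_; _≥_)
open import Data.Nat.Properties using (m^n≢0)
open import Data.Integer using (+_)
open import Data.Rational using (ℚ; _/_; _+_; _-_; _<_; _≤_; 1ℚ)
open import Data.Product using (Σ; ∃; _×_; _,_)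
open import Data.Empty using (⊥)
open import Relation.Nullary using (¬_)
open import Relation.Binary.PropositionalEquality using (_≡_)

-- Binary words; the letter 0 is `false`, the letter 1 is `true`.
Word : Set
Word = List Bool

μ₁ : Bool → Word
μ₁ false = false ∷ true ∷ []
μ₁ true  = true ∷ false ∷ []

μ : Word → Word
μ = concatMap μ₁

μ^ : ℕ → Word → Word
μ^ zero    w = w
μ^ (suc s) w = μ (μ^ s w)

δ^ : ℕ → Word → Word
δ^ t w = drop t w

⟨_⟩ : ℕ → ℚ
⟨ n ⟩ = (+ n) / 1

_/2^_ : ℕ → ℕ → ℚ
t /2^ s = _/_ (+ t) (2 ^ s) {{m^n≢0 2 s}}

Factor : Word → Word → Set
Factor u w = Σ Word λ a → Σ Word λ b → w ≡ a ++ u ++ b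

Prefix : Word → Word → Set
Prefix u w = Σ Word λ b → w ≡ u ++ b

InL : Word → Set
InL w = Σ Word λ u → Factor w (μ u)

-- w is a β power with period p:  w = x^n x', x' prefix of x, n ≥ 1,
-- β = n + |x'|/|x|, and p = |x|  (x is nonempty: x = a ∷ xs).
PowerWithPeriod : Word → ℚ → ℕ → Set
PowerWithPeriod w β p =
  Σ Bool λ a → Σ Word λ xs → Σ Word λ x' → Σ ℕ λ n →
    n ≥ 1 × Prefix x' (a ∷ xs) ×
    w ≡ concat (replicate n (a ∷ xs)) ++ x' ×
    β ≡ ⟨ n ⟩ + (+ length x') / length (a ∷ xs) ×
    p ≡ length (a ∷ xs)

Power : Word → ℚ → Set
Power w β = Σ ℕ λ p → PowerWithPeriod w β p

ContainsPowerWithPeriod : Word → ℚ → ℕ → Set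
ContainsPowerWithPeriod w γ p = Σ Word λ u → Factor u w × PowerWithPeriod u γ p

-- A real number α, represented by its (open) lower Dedekind cut
-- Below q  ⇔  q < α.
record LowerReal : Set₁ where
  field
    Below      : ℚ → Set
    inhabited  : Σ ℚ λ q → Below q
    bounded    : Σ ℚ λ q → ¬ Below q
    downClosed : ∀ {p q} → p ≤ q → Below q → Below p
    rounded    : ∀ {q} → Below q → Σ ℚ λ q' → q < q' × Below q'
open LowerReal public

IsCeil : LowerReal → ℕ → Set
IsCeil α r = Below α (⟨ r ⟩ - 1ℚ) × ¬ Below α ⟨ r ⟩

PowerFree : LowerReal → Word → Set
PowerFree α w = ∀ u β → Factor u w → Power u β → Below α β

module Submission where

-- Deleting the first t letters of μˢ(0ʳv) leaves (00yx)ʳ⁻¹00y μˢ(v),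
-- whose prefix (00yx)ʳ⁻¹00y is a power of period 2ˢ and exponent r − t/2ˢ, and μˢ maps a γ power of
-- period p in 00v to a γ power of period 2ˢp. For power-freeness, a factor of exponent greater than 2
-- of δᵗμˢ(0ʳv) pulls back through μ one step at a time: in μ(w), such a factor cannot have an odd period,
-- and an even period halves. The resulting periodic window of 0ʳv lies inside 00v (exponent < α because
-- 00v is α power-free), or inside 0ʳ (exponent ≤ r − t/2ˢ < α), or straddles their border, which would
-- put 000 into 00v ∈ 𝓛, impossible as μ(u) has no two equal letters at positions 2h, 2h + 1.

open import Defs using (Word; μ^)
open import Data.Bool using (false)
open import Data.List using ([]; _∷_; _++_; length)
open import Data.Nat using (ℕ)
open import Relation.Binary.PropositionalEquality using (_≡_)

module Fractions where
  open import Defs using (⟨_⟩)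
  open import Data.Nat as ℕ using (ℕ; suc; NonZero; _≤_; _<_; _∸_)
  import Data.Nat.Properties as ℕₚ
  open import Data.Integer as ℤ using (+_; _⊖_)
  import Data.Integer.Properties as ℤₚ
  open import Data.Rational as ℚ using (_/_; toℚᵘ)
  import Data.Rational.Properties as ℚₚ
  open import Data.Rational.Unnormalised as ℚᵘ using (mkℚᵘ; *≡*; *≤*; *<*)
  import Data.Rational.Unnormalised.Properties as ℚᵘₚ
  open import Relation.Binary.PropositionalEquality

  toℚᵘ-/ : ∀ n d → toℚᵘ ((+ n) / suc d) ℚᵘ.≃ mkℚᵘ (+ n) d
  toℚᵘ-/ n d = ℚₚ.toℚᵘ-fromℚᵘ (mkℚᵘ (+ n) d)

  m*e≤n*d⇒m/d≤n/e : ∀ m n d e .{{_ : NonZero d}} .{{_ : NonZero e}} →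
                    m ℕ.* e ≤ n ℕ.* d → (+ m) / d ℚ.≤ (+ n) / e
  m*e≤n*d⇒m/d≤n/e m n (suc d) (suc e) me≤nd = ℚₚ.toℚᵘ-cancel-≤
    (ℚᵘₚ.≤-respˡ-≃ (ℚᵘₚ.≃-sym (toℚᵘ-/ m d)) (ℚᵘₚ.≤-respʳ-≃ (ℚᵘₚ.≃-sym (toℚᵘ-/ n e))
      (*≤* (subst₂ ℤ._≤_ (ℤₚ.pos-* m (suc e)) (ℤₚ.pos-* n (suc d)) (ℤ.+≤+ me≤nd)))))

  m*e≡n*d⇒m/d≡n/e : ∀ m n d e .{{_ : NonZero d}} .{{_ : NonZero e}} →
                    m ℕ.* e ≡ n ℕ.* d → (+ m) / d ≡ (+ n) / e
  m*e≡n*d⇒m/d≡n/e m n (suc d) (suc e) me≡nd = ℚₚ.toℚᵘ-injective (ℚᵘₚ.≃-trans (toℚᵘ-/ m d)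
    (ℚᵘₚ.≃-trans (*≡* (trans (sym (ℤₚ.pos-* m (suc e))) (trans (cong +_ me≡nd) (ℤₚ.pos-* n (suc d)))))
      (ℚᵘₚ.≃-sym (toℚᵘ-/ n e))))

  m+k/d≡[m*d+k]/d : ∀ m k d .{{_ : NonZero d}} → ⟨ m ⟩ ℚ.+ (+ k) / d ≡ (+ (m ℕ.* d ℕ.+ k)) / d
  m+k/d≡[m*d+k]/d m k (suc d) = ℚₚ.toℚᵘ-injective (ℚᵘₚ.≃-trans (ℚₚ.toℚᵘ-homo-+ ⟨ m ⟩ ((+ k) / suc d))
    (ℚᵘₚ.≃-trans (ℚᵘₚ.+-cong (toℚᵘ-/ m 0) (toℚᵘ-/ k d))
      (ℚᵘₚ.≃-trans (*≡* cross) (ℚᵘₚ.≃-sym (toℚᵘ-/ (m ℕ.* suc d ℕ.+ k) d)))))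
    where
    D = suc d
    numerator : + (m ℕ.* D ℕ.+ k) ≡ + m ℤ.* + D ℤ.+ + k
    numerator = trans (ℤₚ.pos-+ (m ℕ.* D) k) (cong (ℤ._+ + k) (ℤₚ.pos-* m D))
    cross : (+ m ℤ.* + D ℤ.+ + k ℤ.* + 1) ℤ.* + D ≡ + (m ℕ.* D ℕ.+ k) ℤ.* + suc (d ℕ.+ 0)
    cross = begin
      (+ m ℤ.* + D ℤ.+ + k ℤ.* + 1) ℤ.* + D
        ≡⟨ cong (λ b → (+ m ℤ.* + D ℤ.+ b) ℤ.* + D) (ℤₚ.*-identityʳ (+ k)) ⟩
      (+ m ℤ.* + D ℤ.+ + k) ℤ.* + D
        ≡⟨ cong₂ ℤ._*_ (sym numerator) (cong (λ e → + suc e) (sym (ℕₚ.+-identityʳ d))) ⟩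
      + (m ℕ.* D ℕ.+ k) ℤ.* + suc (d ℕ.+ 0)
        ∎
      where open ≡-Reasoning

  toℚᵘ-m-t/d : ∀ m t d → toℚᵘ (⟨ m ⟩ ℚ.- (+ t) / suc d) ℚᵘ.≃ mkℚᵘ (m ℕ.* suc d ⊖ t) d
  toℚᵘ-m-t/d m t d = ℚᵘₚ.≃-trans (ℚₚ.toℚᵘ-homo-+ ⟨ m ⟩ (ℚ.- ((+ t) / suc d)))
    (ℚᵘₚ.≃-trans (ℚᵘₚ.+-cong (toℚᵘ-/ m 0)
                               (ℚᵘₚ.≃-trans (ℚₚ.toℚᵘ-homo‿- ((+ t) / suc d)) (ℚᵘₚ.-‿cong (toℚᵘ-/ t d))))
    (*≡* cross))
    where
    D = suc d
    cross : (+ m ℤ.* + D ℤ.+ ℤ.- + t ℤ.* + 1) ℤ.* + D ≡ (m ℕ.* D ⊖ t) ℤ.* + suc (d ℕ.+ 0)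
    cross = begin
      (+ m ℤ.* + D ℤ.+ ℤ.- + t ℤ.* + 1) ℤ.* + D
        ≡⟨ cong (λ b → (+ m ℤ.* + D ℤ.+ b) ℤ.* + D) (ℤₚ.*-identityʳ (ℤ.- + t)) ⟩
      (+ m ℤ.* + D ℤ.+ ℤ.- + t) ℤ.* + D
        ≡⟨ cong (λ a → (a ℤ.+ ℤ.- + t) ℤ.* + D) (sym (ℤₚ.pos-* m D)) ⟩
      (+ (m ℕ.* D) ℤ.+ ℤ.- + t) ℤ.* + D
        ≡⟨ cong₂ ℤ._*_ (ℤₚ.m-n≡m⊖n (m ℕ.* D) t) (cong (λ e → + suc e) (sym (ℕₚ.+-identityʳ d))) ⟩
      (m ℕ.* D ⊖ t) ℤ.* + suc (d ℕ.+ 0)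
        ∎
      where open ≡-Reasoning

  m-t/d≡[m*d∸t]/d : ∀ m t d .{{_ : NonZero d}} → t ≤ m ℕ.* d → ⟨ m ⟩ ℚ.- (+ t) / d ≡ (+ (m ℕ.* d ∸ t)) / d
  m-t/d≡[m*d∸t]/d m t (suc d) t≤md = ℚₚ.toℚᵘ-injective (ℚᵘₚ.≃-trans (toℚᵘ-m-t/d m t d)
    (ℚᵘₚ.≃-trans (ℚᵘₚ.≃-reflexive (cong (λ n → mkℚᵘ n d) (ℤₚ.⊖-≥ t≤md)))
                 (ℚᵘₚ.≃-sym (toℚᵘ-/ (m ℕ.* suc d ∸ t) d))))

  k<m-t/d⇒k<m : ∀ k m t d .{{_ : NonZero d}} → ⟨ k ⟩ ℚ.< ⟨ m ⟩ ℚ.- (+ t) / d → k < m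
  k<m-t/d⇒k<m k m t (suc d) k<m-t/d
    with ℚᵘₚ.<-respˡ-≃ (toℚᵘ-/ k 0) (ℚᵘₚ.<-respʳ-≃ (toℚᵘ-m-t/d m t d) (ℚₚ.toℚᵘ-mono-< k<m-t/d))
  ... | *<* kD<[mD⊖t] = ℕₚ.*-cancelʳ-< (suc d) k m (ℤₚ.drop‿+<+ (begin-strict
    + (k ℕ.* suc d)        ≡⟨ ℤₚ.pos-* k (suc d) ⟩
    + k ℤ.* + suc d        <⟨ kD<[mD⊖t] ⟩
    (m ℕ.* suc d ⊖ t) ℤ.* + 1 ≡⟨ ℤₚ.*-identityʳ _ ⟩
    m ℕ.* suc d ⊖ t        ≤⟨ ℤₚ.m⊖n≤m (m ℕ.* suc d) t ⟩
    + (m ℕ.* suc d)        ∎))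
    where open ℤₚ.≤-Reasoning

module Words where
  open import Defs
  open import Data.Bool using (Bool; false)
  open import Data.List using ([]; _∷_; _++_; length; take; drop; replicate)
  open import Data.List.Properties using (++-assoc; length-take; length-drop; take++drop≡id)
  open import Data.Nat using (ℕ; zero; suc; _+_; _≤_; _<_; z≤n; s≤s)
  open import Data.Nat.Properties
  open import Data.Product using (_,_)
  open import Relation.Binary.PropositionalEquality

  -- Positions past the end of a word read as `false`; every lookup below is in range.
  infixl 8 _!_
  _!_ : Word → ℕ → Bool
  []      ! _     = false
  (c ∷ w) ! zero  = c
  (c ∷ w) ! suc k = w ! k

  !-++ʳ : ∀ a b k → (a ++ b) ! (length a + k) ≡ b ! k
  !-++ʳ []      b k = refl
  !-++ʳ (c ∷ a) b k = !-++ʳ a b k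

  !-++ˡ : ∀ a b {k} → k < length a → (a ++ b) ! k ≡ a ! k
  !-++ˡ (c ∷ a) b {zero}  _         = refl
  !-++ˡ (c ∷ a) b {suc k} (s≤s k<a) = !-++ˡ a b k<a

  !-drop : ∀ t w k → drop t w ! k ≡ w ! (t + k)
  !-drop zero    w       k = refl
  !-drop (suc t) []      k = refl
  !-drop (suc t) (c ∷ w) k = !-drop t w k

  !-take : ∀ n w {k} → k < n → take n w ! k ≡ w ! k
  !-take (suc n) []      _         = refl
  !-take (suc n) (c ∷ w) {zero}  _ = refl
  !-take (suc n) (c ∷ w) {suc k} (s≤s k<n) = !-take n w k<n

  !-replicate : ∀ n {k} → replicate n false ! k ≡ false
  !-replicate zero            = refl
  !-replicate (suc n) {zero}  = refl
  !-replicate (suc n) {suc k} = !-replicate n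

  !-prefix : ∀ {u w} → Prefix u w → ∀ {k} → k < length u → u ! k ≡ w ! k
  !-prefix {u} (b , refl) k<u = sym (!-++ˡ u b k<u)

  !-factor : ∀ {u w} ((a , b , _) : Factor u w) → ∀ {k} → k < length u → u ! k ≡ w ! (length a + k)
  !-factor {u} (a , b , refl) {k} k<u = sym (trans (!-++ʳ a (u ++ b) k) (!-++ˡ u b k<u))

  prefix-by-letters : ∀ u w → length u ≤ length w → (∀ k → k < length u → u ! k ≡ w ! k) → Prefix u w
  prefix-by-letters []      w       _         _     = w , refl
  prefix-by-letters (c ∷ u) (d ∷ w) (s≤s u≤w) agree with prefix-by-letters u w u≤w (λ k k<u → agree (suc k) (s≤s k<u))
  ... | b , refl = b , cong (_∷ u ++ b) (sym (agree 0 (s≤s z≤n)))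

  drop-++ˡ : ∀ t (a b : Word) → t ≤ length a → drop t (a ++ b) ≡ drop t a ++ b
  drop-++ˡ zero    a       b _         = refl
  drop-++ˡ (suc t) (c ∷ a) b (s≤s t≤a) = drop-++ˡ t a b t≤a

  factor-++ˡ : ∀ z {u w} → Factor u w → Factor u (z ++ w)
  factor-++ˡ z {u} (a , b , refl) = z ++ a , b , sym (++-assoc z a (u ++ b))

  drop-length-++ : ∀ (a b : Word) → drop (length a) (a ++ b) ≡ b
  drop-length-++ []      b = refl
  drop-length-++ (c ∷ a) b = drop-length-++ a b

  window : Word → ℕ → ℕ → Word
  window w a L = take L (drop a w)

  length-window : ∀ w a L → a + L ≤ length w → length (window w a L) ≡ L
  length-window w a L a+L≤w = trans (length-take L (drop a w))
    (m≤n⇒m⊓n≡m (subst (L ≤_) (sym (length-drop a w)) (m+n≤o⇒m≤o∸n L (subst (_≤ length w) (+-comm a L) a+L≤w))))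

  !-window : ∀ w a L {j} → j < L → window w a L ! j ≡ w ! (a + j)
  !-window w a L j<L = trans (!-take L (drop a w) j<L) (!-drop a w _)

  window-factor : ∀ w a L → Factor (window w a L) w
  window-factor w a L = take a w , drop L (drop a w) ,
    sym (trans (cong (take a w ++_) (take++drop≡id L (drop a w))) (take++drop≡id a w))

module Periods where
  open Words
  open Fractions using (m+k/d≡[m*d+k]/d)
  open import Defs
  open import Data.List using ([]; _∷_; _++_; length; take; drop; concat; replicate)
  open import Data.List.Properties using (++-assoc; ++-identityʳ; length-++; length-take; length-drop; take++drop≡id)
  open import Data.Nat using (ℕ; zero; suc; _+_; _*_; _≤_; _<_; _≤?_; z≤n; s≤s; NonZero)
  open import Data.Nat.Properties
  open import Data.Integer using (+_)
  open import Data.Rational as ℚ using (_/_)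
  open import Data.Product using (Σ; _×_; _,_)
  open import Relation.Nullary using (yes; no)
  open import Relation.Binary.PropositionalEquality
  open ≡-Reasoning

  Periodic : Word → ℕ → ℕ → ℕ → Set
  Periodic w a L p = ∀ j → a ≤ j → j + p < a + L → w ! j ≡ w ! (j + p)

  HasPeriod : Word → ℕ → Set
  HasPeriod w p = Periodic w 0 (length w) p

  periodic-transfer : ∀ u w {k L p} → (∀ j → j < L → u ! j ≡ w ! (k + j)) →
                      Periodic w k L p → Periodic u 0 L p
  periodic-transfer u w {k} {L} {p} agree per j _ j+p<L = begin
    u ! j             ≡⟨ agree j (≤-<-trans (m≤m+n j p) j+p<L) ⟩
    w ! (k + j)       ≡⟨ per (k + j) (m≤m+n k j) (subst (_< k + L) (sym (+-assoc k j p)) (+-monoʳ-< k j+p<L)) ⟩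
    w ! (k + j + p)   ≡⟨ cong (w !_) (+-assoc k j p) ⟩
    w ! (k + (j + p)) ≡⟨ agree (j + p) j+p<L ⟨
    u ! (j + p)       ∎

  periodic-transfer⁻ : ∀ u w {k L p} → (∀ j → j < L → u ! j ≡ w ! (k + j)) →
                       Periodic u 0 L p → Periodic w k L p
  periodic-transfer⁻ u w {k} {L} {p} agree per j k≤j j+p<k+L with m≤n⇒∃[o]m+o≡n k≤j
  ... | i , refl = begin
    w ! (k + i)       ≡⟨ agree i (≤-<-trans (m≤m+n i p) i+p<L) ⟨
    u ! i             ≡⟨ per i z≤n i+p<L ⟩
    u ! (i + p)       ≡⟨ agree (i + p) i+p<L ⟩
    w ! (k + (i + p)) ≡⟨ cong (w !_) (+-assoc k i p) ⟨
    w ! (k + i + p)   ∎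
    where
    i+p<L : i + p < L
    i+p<L = +-cancelˡ-< k (i + p) L (subst (_< k + L) (+-assoc k i p) j+p<k+L)

  periodic-suffix : ∀ a b {p} → HasPeriod (a ++ b) p → HasPeriod b p
  periodic-suffix a b {p} per = periodic-transfer b (a ++ b) (λ j _ → sym (!-++ʳ a b j))
    (λ j _ j+p<a+b → per j z≤n (subst (j + p <_) (sym (length-++ a)) j+p<a+b))

  shifted-letter : ∀ X rest → HasPeriod (X ++ rest) (length X) →
                   ∀ k → k < length X → k < length rest → rest ! k ≡ X ! k
  shifted-letter X rest per k k<X k<rest = begin
    rest ! k                  ≡⟨ !-++ʳ X rest k ⟨
    (X ++ rest) ! (length X + k) ≡⟨ cong ((X ++ rest) !_) (+-comm (length X) k) ⟩
    (X ++ rest) ! (k + length X) ≡⟨ per k z≤n k+X<X++rest ⟨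
    (X ++ rest) ! k           ≡⟨ !-++ˡ X rest k<X ⟩
    X ! k                     ∎
    where
    k+X<X++rest : k + length X < length (X ++ rest)
    k+X<X++rest = subst₂ _<_ (+-comm (length X) k) (sym (length-++ X)) (+-monoʳ-< (length X) k<rest)

  repeat : ℕ → Word → Word
  repeat n X = concat (replicate n X)

  length-repeat : ∀ n X → length (repeat n X) ≡ n * length X
  length-repeat zero    X = refl
  length-repeat (suc n) X = trans (length-++ X) (cong (_+_ (length X)) (length-repeat n X))

  prefix-++ : ∀ {u w} z → Prefix u w → Prefix u (w ++ z)
  prefix-++ {u} z (b , refl) = b ++ z , ++-assoc u b z

  repeat-prefix : ∀ {X x'} → Prefix x' X → ∀ m → Prefix (repeat m X ++ x') (repeat (suc m) X ++ x')
  repeat-prefix pre zero = prefix-++ _ (prefix-++ [] pre)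
  repeat-prefix {X} {x'} pre (suc m) with repeat-prefix pre m
  ... | b , eq = b , (begin
    (X ++ repeat (suc m) X) ++ x'   ≡⟨ ++-assoc X _ x' ⟩
    X ++ (repeat (suc m) X ++ x')   ≡⟨ cong (X ++_) eq ⟩
    X ++ ((repeat m X ++ x') ++ b)  ≡⟨ ++-assoc X _ b ⟨
    (X ++ (repeat m X ++ x')) ++ b  ≡⟨ cong (_++ b) (++-assoc X _ x') ⟨
    ((X ++ repeat m X) ++ x') ++ b  ∎)

  repeat-rotate : ∀ n (a b : Word) → a ++ repeat n (b ++ a) ≡ repeat n (a ++ b) ++ a
  repeat-rotate zero    a b = ++-identityʳ a
  repeat-rotate (suc n) a b = begin
    a ++ ((b ++ a) ++ repeat n (b ++ a)) ≡⟨ cong (a ++_) (++-assoc b a _) ⟩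
    a ++ (b ++ (a ++ repeat n (b ++ a))) ≡⟨ ++-assoc a b _ ⟨
    (a ++ b) ++ (a ++ repeat n (b ++ a)) ≡⟨ cong ((a ++ b) ++_) (repeat-rotate n a b) ⟩
    (a ++ b) ++ (repeat n (a ++ b) ++ a) ≡⟨ ++-assoc (a ++ b) _ a ⟨
    repeat (suc n) (a ++ b) ++ a         ∎

  power⇒periodic : ∀ {u β p} → PowerWithPeriod u β p → HasPeriod u p
  power⇒periodic (c , xs , x' , suc m , _ , pre , refl , _ , refl) j _ j+X<u = sym (begin
    ((X ++ repeat m X) ++ x') ! (j + length X) ≡⟨ cong (_! (j + length X)) (++-assoc X (repeat m X) x') ⟩
    (X ++ v) ! (j + length X)                  ≡⟨ cong ((X ++ v) !_) (+-comm j (length X)) ⟩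
    (X ++ v) ! (length X + j)                  ≡⟨ !-++ʳ X v j ⟩
    v ! j                                      ≡⟨ !-prefix (repeat-prefix pre m) j<v ⟩
    ((X ++ repeat m X) ++ x') ! j              ∎)
    where
    X = c ∷ xs
    v = repeat m X ++ x'
    j<v : j < length v
    j<v = +-cancelʳ-< (length X) j (length v) (subst (j + length X <_)
      (trans (cong length (++-assoc X (repeat m X) x')) (trans (length-++ X) (+-comm (length X) (length v)))) j+X<u)

  repeat-exponent : ∀ n c xs x' →
    ⟨ n ⟩ ℚ.+ (+ length x') / length (c ∷ xs) ≡ (+ length (repeat n (c ∷ xs) ++ x')) / length (c ∷ xs)
  repeat-exponent n c xs x' = trans (m+k/d≡[m*d+k]/d n (length x') (length (c ∷ xs)))
    (cong (λ l → (+ l) / length (c ∷ xs))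
      (sym (trans (length-++ (repeat n (c ∷ xs))) (cong (_+ length x') (length-repeat n (c ∷ xs))))))

  repeat-power : ∀ {n} c xs x' → 1 ≤ n → Prefix x' (c ∷ xs) →
    PowerWithPeriod (repeat n (c ∷ xs) ++ x') ((+ length (repeat n (c ∷ xs) ++ x')) / length (c ∷ xs)) (length (c ∷ xs))
  repeat-power {n} c xs x' 1≤n pre = c , xs , x' , n , 1≤n , pre , refl , sym (repeat-exponent n c xs x') , refl

  -- `fuel` only bounds the recursion, each step of which strips one copy of X off `rest`.
  periodic-decomposition : ∀ fuel X rest → length rest ≤ fuel → 1 ≤ length X → HasPeriod (X ++ rest) (length X) →
                           Σ ℕ λ m → Σ Word λ x' → Prefix x' X × rest ≡ repeat m X ++ x'
  periodic-decomposition zero    X []      _ _ _ = 0 , [] , (X , refl) , refl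
  periodic-decomposition (suc f) X rest rest≤f+1 1≤X per with length X ≤? length rest
  ... | no X≰rest = 0 , rest ,
    prefix-by-letters rest X rest≤X (λ k k<rest → shifted-letter X rest per k (<-≤-trans k<rest rest≤X) k<rest) , refl
    where
    rest≤X : length rest ≤ length X
    rest≤X = <⇒≤ (≰⇒> X≰rest)
  ... | yes X≤rest
    with prefix-by-letters X rest X≤rest (λ k k<X → sym (shifted-letter X rest per k k<X (<-≤-trans k<X X≤rest)))
  ... | rest′ , refl
    with periodic-decomposition f X rest′ rest′≤f 1≤X (periodic-suffix X (X ++ rest′) per)
    where
    rest′≤f : length rest′ ≤ f
    rest′≤f = ≤-pred (≤-trans (+-monoˡ-≤ (length rest′) 1≤X) (subst (_≤ suc f) (length-++ X) rest≤f+1))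
  ... | m , x' , pre , refl = suc m , x' , pre , sym (++-assoc X (repeat m X) x')

  periodic⇒power : ∀ u p .{{_ : NonZero p}} → p ≤ length u → HasPeriod u p → PowerWithPeriod u ((+ length u) / p) p
  periodic⇒power (c ∷ u′) (suc q) (s≤s q≤u′) per = power-of (periodic-decomposition (length u′) X rest
    (subst (_≤ length u′) (sym (length-drop q u′)) (m∸n≤m (length u′) q))
    (s≤s z≤n) (subst₂ HasPeriod u≡X++rest (cong suc (sym ∣take∣≡q)) per))
    where
    X = c ∷ take q u′
    rest = drop q u′
    ∣take∣≡q : length (take q u′) ≡ q
    ∣take∣≡q = trans (length-take q u′) (m≤n⇒m⊓n≡m q≤u′)
    u≡X++rest : c ∷ u′ ≡ X ++ rest
    u≡X++rest = cong (c ∷_) (sym (take++drop≡id q u′))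
    power-of : (Σ ℕ λ m → Σ Word λ x' → Prefix x' X × rest ≡ repeat m X ++ x') →
               PowerWithPeriod (c ∷ u′) ((+ length (c ∷ u′)) / suc q) (suc q)
    power-of (m , x' , pre , rest≡) = subst₂ (λ w n → PowerWithPeriod w ((+ length w) / suc n) (suc n))
      (sym (trans u≡X++rest (trans (cong (X ++_) rest≡) (sym (++-assoc X (repeat m X) x'))))) ∣take∣≡q
      (repeat-power {suc m} c (take q u′) x' (s≤s z≤n) pre)

module Halves where
  open import Data.Nat using (ℕ; zero; suc; _*_; _≤_; z≤n; s≤s; ⌊_/2⌋; ⌈_/2⌉)
  open import Data.Nat.Properties using (*-suc; ≤-pred)
  open import Data.Product using (Σ; _,_)
  open import Data.Sum using (_⊎_; inj₁; inj₂)
  open import Relation.Binary.PropositionalEquality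

  parity : ∀ n → Σ ℕ λ h → n ≡ 2 * h ⊎ n ≡ suc (2 * h)
  parity zero          = 0 , inj₁ refl
  parity (suc zero)    = 0 , inj₂ refl
  parity (suc (suc n)) with parity n
  ... | h , inj₁ refl = suc h , inj₁ (sym (*-suc 2 h))
  ... | h , inj₂ refl = suc h , inj₂ (cong suc (sym (*-suc 2 h)))

  2*⌊n/2⌋≤n : ∀ n → 2 * ⌊ n /2⌋ ≤ n
  2*⌊n/2⌋≤n zero          = z≤n
  2*⌊n/2⌋≤n (suc zero)    = z≤n
  2*⌊n/2⌋≤n (suc (suc n)) = subst (_≤ suc (suc n)) (sym (*-suc 2 ⌊ n /2⌋)) (s≤s (s≤s (2*⌊n/2⌋≤n n)))

  n≤1+2*⌊n/2⌋ : ∀ n → n ≤ suc (2 * ⌊ n /2⌋)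
  n≤1+2*⌊n/2⌋ zero          = z≤n
  n≤1+2*⌊n/2⌋ (suc zero)    = s≤s z≤n
  n≤1+2*⌊n/2⌋ (suc (suc n)) = subst (suc (suc n) ≤_) (cong suc (sym (*-suc 2 ⌊ n /2⌋))) (s≤s (s≤s (n≤1+2*⌊n/2⌋ n)))

  n≤2*⌈n/2⌉ : ∀ n → n ≤ 2 * ⌈ n /2⌉
  n≤2*⌈n/2⌉ n = ≤-pred (n≤1+2*⌊n/2⌋ (suc n))

  2*⌈n/2⌉≤1+n : ∀ n → 2 * ⌈ n /2⌉ ≤ suc n
  2*⌈n/2⌉≤1+n n = 2*⌊n/2⌋≤n (suc n)

module ThueMorse where
  open Words
  open Periods
  open Halves using (parity)
  open Fractions using (m*e≡n*d⇒m/d≡n/e)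
  open import Defs
  open import Data.Bool using (Bool; true; false; not)
  open import Data.List using ([]; _∷_; _++_; length; replicate)
  open import Data.List.Properties using (length-++; concatMap-++)
  open import Data.Nat using (ℕ; zero; suc; _+_; _*_; _^_; _<_; s≤s)
  open import Data.Nat.Properties
  import Data.Integer as ℤ
  open import Data.Rational as ℚ using (_/_)
  open import Data.Product using (Σ; _,_)
  open import Data.Sum using (_⊎_; inj₁; inj₂)
  open import Data.Empty using (⊥)
  open import Relation.Binary.PropositionalEquality

  μ-++ : ∀ a b → μ (a ++ b) ≡ μ a ++ μ b
  μ-++ = concatMap-++ μ₁

  μ^-++ : ∀ s a b → μ^ s (a ++ b) ≡ μ^ s a ++ μ^ s b
  μ^-++ zero    a b = refl
  μ^-++ (suc s) a b = trans (cong μ (μ^-++ s a b)) (μ-++ (μ^ s a) (μ^ s b))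

  μ^-[] : ∀ s → μ^ s [] ≡ []
  μ^-[] zero    = refl
  μ^-[] (suc s) = cong μ (μ^-[] s)

  μ^-repeat : ∀ s n X → μ^ s (repeat n X) ≡ repeat n (μ^ s X)
  μ^-repeat s zero    X = μ^-[] s
  μ^-repeat s (suc n) X = trans (μ^-++ s X (repeat n X)) (cong (μ^ s X ++_) (μ^-repeat s n X))

  replicate≡repeat : ∀ n (c : Bool) → replicate n c ≡ repeat n (c ∷ [])
  replicate≡repeat zero    c = refl
  replicate≡repeat (suc n) c = cong (c ∷_) (replicate≡repeat n c)

  μ^-∷ : ∀ s c xs → Σ Bool λ c′ → Σ Word λ xs′ → μ^ s (c ∷ xs) ≡ c′ ∷ xs′
  μ^-∷ zero    c xs = c , xs , refl
  μ^-∷ (suc s) c xs with μ^-∷ s c xs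
  ... | false , xs′ , eq = false , true ∷ μ xs′ , cong μ eq
  ... | true  , xs′ , eq = true , false ∷ μ xs′ , cong μ eq

  length-μ : ∀ w → length (μ w) ≡ 2 * length w
  length-μ []      = refl
  length-μ (c ∷ w) = trans (length-++ (μ₁ c)) (trans (cong₂ _+_ (length-μ₁ c) (length-μ w)) (sym (*-suc 2 (length w))))
    where
    length-μ₁ : ∀ c → length (μ₁ c) ≡ 2
    length-μ₁ false = refl
    length-μ₁ true  = refl

  length-μ^ : ∀ s w → length (μ^ s w) ≡ 2 ^ s * length w
  length-μ^ zero    w = sym (+-identityʳ (length w))
  length-μ^ (suc s) w = trans (length-μ (μ^ s w)) (trans (cong (2 *_) (length-μ^ s w)) (sym (*-assoc 2 (2 ^ s) (length w))))

  μ-!-even : ∀ w k → μ w ! (2 * k) ≡ w ! k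
  μ-!-even []          k       = refl
  μ-!-even (false ∷ w) zero    = refl
  μ-!-even (true  ∷ w) zero    = refl
  μ-!-even (false ∷ w) (suc k) rewrite +-suc k (k + 0) = μ-!-even w k
  μ-!-even (true  ∷ w) (suc k) rewrite +-suc k (k + 0) = μ-!-even w k

  μ-!-odd : ∀ w {k} → k < length w → μ w ! suc (2 * k) ≡ not (w ! k)
  μ-!-odd (false ∷ w) {zero}  _         = refl
  μ-!-odd (true  ∷ w) {zero}  _         = refl
  μ-!-odd (false ∷ w) {suc k} (s≤s k<w) rewrite +-suc k (k + 0) = μ-!-odd w k<w
  μ-!-odd (true  ∷ w) {suc k} (s≤s k<w) rewrite +-suc k (k + 0) = μ-!-odd w k<w

  μ-!-odd-even : ∀ w {k} → k < length w → μ w ! suc (2 * k) ≡ not (μ w ! (2 * k))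
  μ-!-odd-even w {k} k<w = trans (μ-!-odd w k<w) (cong not (sym (μ-!-even w k)))

  μ^-factor : ∀ s {u w} → Factor u w → Factor (μ^ s u) (μ^ s w)
  μ^-factor s {u} (a , b , refl) = μ^ s a , μ^ s b , trans (μ^-++ s a (u ++ b)) (cong (μ^ s a ++_) (μ^-++ s u b))

  μ^-power : ∀ s {u γ p} → PowerWithPeriod u γ p → PowerWithPeriod (μ^ s u) γ (2 ^ s * p)
  μ^-power s (c , xs , x' , n , 1≤n , (b , X≡x'++b) , refl , refl , refl) with μ^-∷ s c xs
  ... | c′ , xs′ , μˢX≡ = c′ , xs′ , μ^ s x' , n , 1≤n , (μ^ s b , prefix) , word , exponent , sym ∣μˢX∣
    where
    X = c ∷ xs
    ∣μˢX∣ : length (c′ ∷ xs′) ≡ 2 ^ s * length X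
    ∣μˢX∣ = trans (cong length (sym μˢX≡)) (length-μ^ s X)
    prefix : c′ ∷ xs′ ≡ μ^ s x' ++ μ^ s b
    prefix = trans (sym μˢX≡) (trans (cong (μ^ s) X≡x'++b) (μ^-++ s x' b))
    word : μ^ s (repeat n X ++ x') ≡ repeat n (c′ ∷ xs′) ++ μ^ s x'
    word = trans (μ^-++ s (repeat n X) x') (cong (_++ μ^ s x') (trans (μ^-repeat s n X) (cong (repeat n) μˢX≡)))
    cross : length x' * length (c′ ∷ xs′) ≡ length (μ^ s x') * length X
    cross = begin
      length x' * length (c′ ∷ xs′)     ≡⟨ cong (length x' *_) ∣μˢX∣ ⟩
      length x' * (2 ^ s * length X)    ≡⟨ *-assoc (length x') (2 ^ s) (length X) ⟨
      length x' * 2 ^ s * length X      ≡⟨ cong (_* length X) (*-comm (length x') (2 ^ s)) ⟩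
      2 ^ s * length x' * length X      ≡⟨ cong (_* length X) (length-μ^ s x') ⟨
      length (μ^ s x') * length X       ∎
      where open ≡-Reasoning
    exponent : ⟨ n ⟩ ℚ.+ (ℤ.+ length x') / length X ≡ ⟨ n ⟩ ℚ.+ (ℤ.+ length (μ^ s x')) / length (c′ ∷ xs′)
    exponent = cong (⟨ n ⟩ ℚ.+_) (m*e≡n*d⇒m/d≡n/e (length x') (length (μ^ s x')) (length X) (length (c′ ∷ xs′)) cross)

  μ-no-00-at-even : ∀ u h → h < length u → μ u ! (2 * h) ≡ false → μ u ! suc (2 * h) ≡ false → ⊥
  μ-no-00-at-even u h h<u even odd with trans (sym odd) (trans (μ-!-odd-even u h<u) (cong not even))
  ... | ()

  -- Two consecutive positions of a 000 inside μ u are 2h and 2h + 1, where μ u never repeats a letter.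
  InL-avoids-000 : ∀ {D} → InL D → ∀ k → suc (suc k) < length D →
                   D ! k ≡ false → D ! suc k ≡ false → D ! suc (suc k) ≡ false → ⊥
  InL-avoids-000 {D} (u , fac@(a , b , μu≡aDb)) k 2+k<D d₀ d₁ d₂ = by-parity (parity (length a + k))
    where
    1+k<D : suc k < length D
    1+k<D = <-trans (n<1+n (suc k)) 2+k<D
    k<D : k < length D
    k<D = <-trans (n<1+n k) 1+k<D
    at : ∀ {i j} → length a + i ≡ j → i < length D → D ! i ≡ false → μ u ! j ≡ false
    at refl i<D dᵢ = trans (sym (!-factor fac i<D)) dᵢ
    inside : ∀ {i j} → length a + i ≡ j → i < length D → j < 2 * length u
    inside {i} refl i<D = begin-strict
      length a + i                     <⟨ +-monoʳ-< (length a) i<D ⟩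
      length a + length D              ≤⟨ +-monoʳ-≤ (length a) (m≤m+n (length D) (length b)) ⟩
      length a + (length D + length b) ≡⟨ cong (length a +_) (length-++ D) ⟨
      length a + length (D ++ b)       ≡⟨ length-++ a ⟨
      length (a ++ D ++ b)             ≡⟨ cong length μu≡aDb ⟨
      length (μ u)                     ≡⟨ length-μ u ⟩
      2 * length u                     ∎
      where open ≤-Reasoning
    half< : ∀ {h} → suc (2 * h) < 2 * length u → h < length u
    half< {h} lt = *-cancelˡ-< 2 h (length u) (<-trans (n<1+n _) lt)
    by-parity : (Σ ℕ λ h → length a + k ≡ 2 * h ⊎ length a + k ≡ suc (2 * h)) → ⊥
    by-parity (h , inj₁ e) = μ-no-00-at-even u h (half< (inside e₁ 1+k<D)) (at e k<D d₀) (at e₁ 1+k<D d₁)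
      where
      e₁ : length a + suc k ≡ suc (2 * h)
      e₁ = trans (+-suc (length a) k) (cong suc e)
    by-parity (h , inj₂ e) = μ-no-00-at-even u (suc h) (half< (inside e₂ 2+k<D)) (at e₁ 1+k<D d₁) (at e₂ 2+k<D d₂)
      where
      e₁ : length a + suc k ≡ 2 * suc h
      e₁ = trans (+-suc (length a) k) (trans (cong suc e) (sym (*-suc 2 h)))
      e₂ : length a + suc (suc k) ≡ suc (2 * suc h)
      e₂ = trans (+-suc (length a) (suc k)) (cong suc e₁)

module Desubstitution where
  open Words
  open Periods
  open ThueMorse
  open Halves
  open import Defs
  open import Data.Bool using (not)
  open import Data.Bool.Properties using (not-involutive; not-injective; not-¬)
  open import Data.List using (length)
  open import Data.Nat using (ℕ; zero; suc; _+_; _*_; _^_; _∸_; _≤_; _<_; _≤?_; s≤s; ⌊_/2⌋; ⌈_/2⌉; NonZero; ≢-nonZero)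
  open import Data.Nat.Properties
  open import Data.Nat.Tactic.RingSolver using (solve-∀)
  open import Data.Empty using (⊥; ⊥-elim)
  open import Data.Product using (_,_)
  open import Data.Sum using (inj₁; inj₂)
  open import Relation.Nullary using (yes; no)
  open import Relation.Binary.PropositionalEquality

  -- A periodic window [a, a + L) of the image of w under a k-uniform substitution, traced back to a periodic
  -- window [a′, a′ + L′) of w whose image covers it.
  record PeriodicPreimage (k : ℕ) (w : Word) (a L p : ℕ) : Set where
    field
      q a′ L′  : ℕ
      p≡k*q         : p ≡ k * q
      k*a′≤a        : k * a′ ≤ a
      a+L≤k*[a′+L′] : a + L ≤ k * (a′ + L′)
      a′+L′≤∣w∣     : a′ + L′ ≤ length w
      2q<L′         : 2 * q < L′
      periodic      : Periodic w a′ L′ q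

  preimage-cross : ∀ {k w a L p} (P : PeriodicPreimage k w a L p) → let open PeriodicPreimage P in L * q ≤ L′ * p
  preimage-cross {k} {w} {a} {L} {p} P = begin
    L * q          ≤⟨ *-monoˡ-≤ q L≤kL′ ⟩
    k * L′ * q     ≡⟨ *-assoc k L′ q ⟩
    k * (L′ * q)   ≡⟨ cong (k *_) (*-comm L′ q) ⟩
    k * (q * L′)   ≡⟨ *-assoc k q L′ ⟨
    k * q * L′     ≡⟨ *-comm (k * q) L′ ⟩
    L′ * (k * q)   ≡⟨ cong (L′ *_) p≡k*q ⟨
    L′ * p         ∎
    where
    open PeriodicPreimage P
    open ≤-Reasoning
    L≤kL′ : L ≤ k * L′
    L≤kL′ = +-cancelˡ-≤ a L (k * L′) (≤-trans a+L≤k*[a′+L′]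
      (subst (_≤ a + k * L′) (sym (*-distribˡ-+ k a′ L′)) (+-monoˡ-≤ (k * L′) k*a′≤a)))

  preimage-q≢0 : ∀ {k w a L d} (P : PeriodicPreimage k w a L (suc d)) → NonZero (PeriodicPreimage.q P)
  preimage-q≢0 {k} P = ≢-nonZero λ q≡0 → 1+n≢0 (trans p≡k*q (trans (cong (k *_) q≡0) (*-zeroʳ k)))
    where open PeriodicPreimage P

  private
    2j+[2q+1]≡1+2[j+q] : ∀ j q → 2 * j + suc (2 * q) ≡ suc (2 * (j + q))
    2j+[2q+1]≡1+2[j+q] = solve-∀
    1+2j+[2q+1]≡2[1+j+q] : ∀ j q → suc (2 * j) + suc (2 * q) ≡ 2 * suc (j + q)
    1+2j+[2q+1]≡2[1+j+q] = solve-∀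

  -- An odd period 2q + 1 of μ w makes both w(j + q) and w(j + q + 1) equal to ¬ w(j), so w is constant on
  -- [m, m + q] and yet w(m + q) = ¬ w(m).
  module OddPeriod (w : Word) {a L q : ℕ} (a+L≤2w : a + L ≤ 2 * length w) (per : Periodic (μ w) a L (suc (2 * q))) where

    in-w : ∀ {i} → suc (2 * i) < a + L → i < length w
    in-w lt = *-cancelˡ-< 2 _ (length w) (<-≤-trans (<-trans (n<1+n _) lt) a+L≤2w)

    shift-flips : ∀ j → a ≤ 2 * j → suc (2 * (j + q)) < a + L → w ! (j + q) ≡ not (w ! j)
    shift-flips j a≤2j lt = trans (sym (not-involutive _)) (cong not (begin
      not (w ! (j + q))        ≡⟨ μ-!-odd w (in-w lt) ⟨
      μ w ! suc (2 * (j + q))  ≡⟨ cong (μ w !_) (2j+[2q+1]≡1+2[j+q] j q) ⟨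
      μ w ! (2 * j + suc (2 * q)) ≡⟨ per (2 * j) a≤2j (subst (_< a + L) (sym (2j+[2q+1]≡1+2[j+q] j q)) lt) ⟨
      μ w ! (2 * j)            ≡⟨ μ-!-even w j ⟩
      w ! j                    ∎))
      where open ≡-Reasoning

    shift+1-flips : ∀ j → a ≤ 2 * j → suc (2 * suc (j + q)) < a + L → w ! suc (j + q) ≡ not (w ! j)
    shift+1-flips j a≤2j lt = begin
      w ! suc (j + q)                   ≡⟨ μ-!-even w (suc (j + q)) ⟨
      μ w ! (2 * suc (j + q))           ≡⟨ cong (μ w !_) (1+2j+[2q+1]≡2[1+j+q] j q) ⟨
      μ w ! (suc (2 * j) + suc (2 * q)) ≡⟨ per (suc (2 * j)) (≤-trans a≤2j (n≤1+n _)) lt′ ⟨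
      μ w ! suc (2 * j)                 ≡⟨ μ-!-odd w (in-w (≤-<-trans (s≤s (*-monoʳ-≤ 2 (m≤n⇒m≤1+n (m≤m+n j q)))) lt)) ⟩
      not (w ! j)                       ∎
      where
      open ≡-Reasoning
      lt′ : suc (2 * j) + suc (2 * q) < a + L
      lt′ = subst (_< a + L) (sym (1+2j+[2q+1]≡2[1+j+q] j q)) (<-trans (n<1+n _) lt)

    impossible : 2 * suc (2 * q) < L → ⊥
    impossible 2P<L = not-¬ refl (trans (sym (constant q ≤-refl)) (shift-flips m a≤2m (reach (m≤m+n m q))))
      where
      m = ⌈ a /2⌉
      a≤2m : a ≤ 2 * m
      a≤2m = n≤2*⌈n/2⌉ a
      a≤2[m+i] : ∀ i → a ≤ 2 * (m + i)
      a≤2[m+i] i = ≤-trans a≤2m (*-monoʳ-≤ 2 (m≤m+n m i))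
      reach : ∀ {j} → j ≤ m + q → suc (2 * (j + q)) < a + L
      reach {j} j≤m+q = begin-strict
        suc (2 * (j + q))          ≤⟨ s≤s (*-monoʳ-≤ 2 (+-monoˡ-≤ q j≤m+q)) ⟩
        suc (2 * (m + q + q))      ≡⟨ cong suc (distribute m q) ⟩
        suc (2 * m + 2 * (2 * q))  ≤⟨ s≤s (+-monoˡ-≤ (2 * (2 * q)) (2*⌈n/2⌉≤1+n a)) ⟩
        suc (suc a + 2 * (2 * q))  ≡⟨ collect a q ⟩
        a + 2 * suc (2 * q)        <⟨ +-monoʳ-< a 2P<L ⟩
        a + L                      ∎
        where
        open ≤-Reasoning
        distribute : ∀ m q → 2 * (m + q + q) ≡ 2 * m + 2 * (2 * q)
        distribute = solve-∀
        collect : ∀ a q → suc (suc a + 2 * (2 * q)) ≡ a + 2 * suc (2 * q)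
        collect = solve-∀
      constant : ∀ i → i ≤ q → w ! (m + i) ≡ w ! m
      constant zero    _     = cong (w !_) (+-identityʳ m)
      constant (suc i) 1+i≤q = trans (not-injective (begin
        not (w ! (m + suc i))  ≡⟨ shift-flips (m + suc i) (a≤2[m+i] (suc i)) (reach (+-monoʳ-≤ m 1+i≤q)) ⟨
        w ! (m + suc i + q)    ≡⟨ cong (λ j → w ! (j + q)) (+-suc m i) ⟩
        w ! suc (m + i + q)    ≡⟨ shift+1-flips (m + i) (a≤2[m+i] i)
                                    (subst (λ j → suc (2 * (j + q)) < a + L) (+-suc m i) (reach (+-monoʳ-≤ m 1+i≤q))) ⟩
        not (w ! (m + i))      ∎)) (constant i (≤-trans (n≤1+n i) 1+i≤q))
        where open ≡-Reasoning

  -- An even period 2q of a window of μ w comes from period q of the half-size window of w below it, compared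
  -- through even positions of μ w, or through odd ones where the window starts just after an even position.
  module EvenPeriod (w : Word) {a L q : ℕ} (a+L≤2w : a + L ≤ 2 * length w) (2p<L : 2 * (2 * q) < L)
                    (per : Periodic (μ w) a L (2 * q)) where

    halved-letters : ∀ j → a ≤ suc (2 * j) → 2 * (j + q) < a + L → j + q < length w → w ! j ≡ w ! (j + q)
    halved-letters j a≤1+2j lt j+q<w with a ≤? 2 * j
    ... | yes a≤2j = begin
      w ! j                 ≡⟨ μ-!-even w j ⟨
      μ w ! (2 * j)         ≡⟨ per (2 * j) a≤2j (subst (_< a + L) (*-distribˡ-+ 2 j q) lt) ⟩
      μ w ! (2 * j + 2 * q) ≡⟨ cong (μ w !_) (*-distribˡ-+ 2 j q) ⟨
      μ w ! (2 * (j + q))   ≡⟨ μ-!-even w (j + q) ⟩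
      w ! (j + q)           ∎
      where open ≡-Reasoning
    ... | no a≰2j = not-injective (begin
      not (w ! j)                 ≡⟨ μ-!-odd w (≤-<-trans (m≤m+n j q) j+q<w) ⟨
      μ w ! suc (2 * j)           ≡⟨ per (suc (2 * j)) a≤1+2j (+-mono-≤-< (≰⇒> a≰2j) 2q<L) ⟩
      μ w ! (suc (2 * j) + 2 * q) ≡⟨ cong (λ i → μ w ! suc i) (*-distribˡ-+ 2 j q) ⟨
      μ w ! suc (2 * (j + q))     ≡⟨ μ-!-odd w j+q<w ⟩
      not (w ! (j + q))           ∎)
      where
      open ≡-Reasoning
      2q<L : 2 * q < L
      2q<L = ≤-<-trans (m≤n*m (2 * q) 2) 2p<L

    preimage : PeriodicPreimage 2 w a L (2 * q)
    preimage = record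
      { q = q ; a′ = a′ ; L′ = b ∸ a′ ; p≡k*q = refl ; k*a′≤a = 2*⌊n/2⌋≤n a ; a+L≤k*[a′+L′] = end
      ; a′+L′≤∣w∣ = subst (_≤ length w) (sym a′+L′≡b) b≤w ; 2q<L′ = long ; periodic = periodic }
      where
      a′ = ⌊ a /2⌋
      b = ⌈ a + L /2⌉
      a′+L′≡b : a′ + (b ∸ a′) ≡ b
      a′+L′≡b = m+[n∸m]≡n (*-cancelˡ-≤ {a′} {b} 2
        (≤-trans (2*⌊n/2⌋≤n a) (≤-trans (m≤m+n a L) (n≤2*⌈n/2⌉ (a + L)))))
      end : a + L ≤ 2 * (a′ + (b ∸ a′))
      end = subst (λ x → a + L ≤ 2 * x) (sym a′+L′≡b) (n≤2*⌈n/2⌉ (a + L))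
      b≤w : b ≤ length w
      b≤w = ≤-pred (*-cancelˡ-< 2 b (suc (length w))
        (subst (2 * b <_) (sym (*-suc 2 (length w))) (s≤s (≤-trans (2*⌈n/2⌉≤1+n (a + L)) (s≤s a+L≤2w)))))
      long : 2 * q < b ∸ a′
      long = *-cancelˡ-< 2 (2 * q) (b ∸ a′) (<-≤-trans 2p<L (+-cancelˡ-≤ a L (2 * (b ∸ a′)) (begin
        a + L                     ≤⟨ end ⟩
        2 * (a′ + (b ∸ a′))       ≡⟨ *-distribˡ-+ 2 a′ (b ∸ a′) ⟩
        2 * a′ + 2 * (b ∸ a′)     ≤⟨ +-monoˡ-≤ (2 * (b ∸ a′)) (2*⌊n/2⌋≤n a) ⟩
        a + 2 * (b ∸ a′)          ∎)))
        where open ≤-Reasoning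
      periodic : Periodic w a′ (b ∸ a′) q
      periodic j a′≤j j+q<a′+L′ = halved-letters j
        (≤-trans (n≤1+2*⌊n/2⌋ a) (s≤s (*-monoʳ-≤ 2 a′≤j)))
        (≤-pred (subst (_≤ suc (a + L)) (*-suc 2 (j + q)) (≤-trans (*-monoʳ-≤ 2 j+q<b) (2*⌈n/2⌉≤1+n (a + L)))))
        (<-≤-trans j+q<b b≤w)
        where
        j+q<b : j + q < b
        j+q<b = subst (j + q <_) a′+L′≡b j+q<a′+L′

  μ-preimage : ∀ w {a L p} → a + L ≤ 2 * length w → 2 * p < L → Periodic (μ w) a L p → PeriodicPreimage 2 w a L p
  μ-preimage w {p = p} a+L≤2w 2p<L per with parity p
  ... | q , inj₁ refl = EvenPeriod.preimage w {q = q} a+L≤2w 2p<L per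
  ... | q , inj₂ refl = ⊥-elim (OddPeriod.impossible w {q = q} a+L≤2w per 2p<L)

  preimage-∘ : ∀ {k k′ W w a L p} (P : PeriodicPreimage k W a L p) → let open PeriodicPreimage P in
               PeriodicPreimage k′ w a′ L′ q → PeriodicPreimage (k * k′) w a L p
  preimage-∘ {k} {k′} P P′ = record
    { q = P′.q ; a′ = P′.a′ ; L′ = P′.L′
    ; p≡k*q    = trans P.p≡k*q (trans (cong (k *_) P′.p≡k*q) (sym (*-assoc k k′ P′.q)))
    ; k*a′≤a   = ≤-trans (≤-reflexive (*-assoc k k′ P′.a′)) (≤-trans (*-monoʳ-≤ k P′.k*a′≤a) P.k*a′≤a)
    ; a+L≤k*[a′+L′] = ≤-trans P.a+L≤k*[a′+L′]
        (≤-trans (*-monoʳ-≤ k P′.a+L≤k*[a′+L′]) (≤-reflexive (sym (*-assoc k k′ (P′.a′ + P′.L′)))))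
    ; a′+L′≤∣w∣ = P′.a′+L′≤∣w∣ ; 2q<L′ = P′.2q<L′ ; periodic = P′.periodic }
    where
    module P = PeriodicPreimage P
    module P′ = PeriodicPreimage P′

  μ^-preimage : ∀ s w {a L p} → a + L ≤ 2 ^ s * length w → 2 * p < L → Periodic (μ^ s w) a L p →
                PeriodicPreimage (2 ^ s) w a L p
  μ^-preimage zero w {a} {L} {p} a+L≤w 2p<L per = record
    { q = p ; a′ = a ; L′ = L ; p≡k*q = sym (*-identityˡ p) ; k*a′≤a = ≤-reflexive (*-identityˡ a)
    ; a+L≤k*[a′+L′] = ≤-reflexive (sym (*-identityˡ (a + L)))
    ; a′+L′≤∣w∣ = subst (a + L ≤_) (*-identityˡ (length w)) a+L≤w
    ; 2q<L′ = 2p<L ; periodic = per }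
  μ^-preimage (suc s) w {a} {L} a+L≤w 2p<L per =
    preimage-∘ P (μ^-preimage s w (subst (P.a′ + P.L′ ≤_) (length-μ^ s w) P.a′+L′≤∣w∣) P.2q<L′ P.periodic)
    where
    P = μ-preimage (μ^ s w)
      (subst (a + L ≤_) (trans (*-assoc 2 (2 ^ s) (length w)) (cong (2 *_) (sym (length-μ^ s w)))) a+L≤w) 2p<L per
    module P = PeriodicPreimage P

module ZerosThen (n : ℕ) (v : Word) where
  open Words
  open Periods
  open ThueMorse using (InL-avoids-000)
  open import Defs
  open import Data.Bool using (false)
  open import Data.List using (_∷_; _++_; length; replicate)
  open import Data.List.Properties using (length-++; length-replicate)
  open import Data.Nat using (ℕ; zero; suc; _+_; _*_; _∸_; _≤_; _<_; _≤?_; z≤n; s≤s)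
  open import Data.Nat.Properties
  open import Data.Product using (Σ; _×_; _,_)
  open import Data.Empty using (⊥)
  open import Relation.Nullary using (yes; no)
  open import Relation.Binary.PropositionalEquality

  D : Word
  D = false ∷ false ∷ v

  w : Word
  w = replicate (suc (suc n)) false ++ v

  w≡0ⁿD : w ≡ replicate n false ++ D
  w≡0ⁿD = trans (cong (false ∷_) (shift n v)) (shift n (false ∷ v))
    where
    shift : ∀ m u → false ∷ replicate m false ++ u ≡ replicate m false ++ false ∷ u
    shift zero    u = refl
    shift (suc m) u = cong (false ∷_) (shift m u)

  length-w : length w ≡ n + length D
  length-w = trans (cong length w≡0ⁿD) (trans (length-++ (replicate n false)) (cong (_+ length D) (length-replicate n)))

  !-zeros : ∀ {k} → k < suc (suc n) → w ! k ≡ false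
  !-zeros {k} k<2+n =
    trans (!-++ˡ (replicate (suc (suc n)) false) v (subst (k <_) (sym (length-replicate (suc (suc n)))) k<2+n))
          (!-replicate (suc (suc n)) {k})

  !-D : ∀ j → w ! (n + j) ≡ D ! j
  !-D j = trans (cong (_! (n + j)) w≡0ⁿD)
    (subst (λ m → (replicate n false ++ D) ! (m + j) ≡ D ! j) (length-replicate n) (!-++ʳ (replicate n false) D j))

  000-after-zeros : InL D → ∀ k → n ≤ k → suc (suc k) < length w →
                    w ! k ≡ false → w ! suc k ≡ false → w ! suc (suc k) ≡ false → ⊥
  000-after-zeros D∈𝓛 k n≤k 2+k<w z₀ z₁ z₂ with m≤n⇒∃[o]m+o≡n n≤k
  ... | i , refl = InL-avoids-000 D∈𝓛 i 2+i<D (in-D i z₀)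
    (in-D (suc i) (subst (λ m → w ! m ≡ false) (sym (+-suc n i)) z₁))
    (in-D (suc (suc i)) (subst (λ m → w ! m ≡ false) (sym (trans (+-suc n (suc i)) (cong suc (+-suc n i)))) z₂))
    where
    in-D : ∀ j → w ! (n + j) ≡ false → D ! j ≡ false
    in-D j = trans (sym (!-D j))
    2+i<D : suc (suc i) < length D
    2+i<D = +-cancelˡ-< n (suc (suc i)) (length D)
      (subst₂ _<_ (sym (trans (+-suc n (suc i)) (cong suc (+-suc n i)))) length-w 2+k<w)

  -- The period copies zeros of the block 0ⁿ⁺² either onto position n + 2 (if a + q ≤ n + 2) or onto
  -- a + q, a + q + 1, a + q + 2; either way D would contain 000.
  straddling-window-impossible : InL D → ∀ {a L q} → Periodic w a L q → 0 < q → 2 * q < L →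
                                 a < n → suc (suc n) < a + L → a + L ≤ length w → ⊥
  straddling-window-impossible D∈𝓛 {a} {L} {q} per 0<q 2q<L a<n 2+n<a+L a+L≤w with a + q ≤? suc (suc n)
  ... | yes a+q≤2+n = 000-after-zeros D∈𝓛 n ≤-refl (<-≤-trans 2+n<a+L a+L≤w)
    (!-zeros (m<n⇒m<1+n (n<1+n n))) (!-zeros (n<1+n (suc n))) w[2+n]≡false
    where
    j = suc (suc n) ∸ q
    j+q≡2+n : j + q ≡ suc (suc n)
    j+q≡2+n = m∸n+n≡m (≤-trans (m≤n+m q a) a+q≤2+n)
    w[2+n]≡false : w ! suc (suc n) ≡ false
    w[2+n]≡false = trans (cong (w !_) (sym j+q≡2+n))
      (trans (sym (per j (m+n≤o⇒m≤o∸n a a+q≤2+n) (subst (_< a + L) (sym j+q≡2+n) 2+n<a+L)))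
             (!-zeros (∸-monoʳ-< 0<q (≤-trans (m≤n+m q a) a+q≤2+n))))
  ... | no a+q≰2+n = 000-after-zeros D∈𝓛 (a + q) (≤-trans (m≤n+m n 2) (<⇒≤ 2+n<a+q))
    (<-≤-trans (bound 2 (s≤s (s≤s (s≤s z≤n)))) a+L≤w)
    (shifted 0 (s≤s z≤n)) (shifted 1 (s≤s (s≤s z≤n))) (shifted 2 (s≤s (s≤s (s≤s z≤n))))
    where
    2+n<a+q : suc (suc n) < a + q
    2+n<a+q = ≰⇒> a+q≰2+n
    a+3≤2+n : a + 3 ≤ suc (suc n)
    a+3≤2+n = subst (_≤ suc (suc n)) (+-comm 3 a) (s≤s (s≤s a<n))
    3≤q : 3 ≤ q
    3≤q = +-cancelˡ-≤ a 3 q (<⇒≤ (≤-<-trans a+3≤2+n 2+n<a+q))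
    reorder : ∀ i → i + (a + q) ≡ a + i + q
    reorder i = trans (sym (+-assoc i a q)) (cong (_+ q) (+-comm i a))
    bound : ∀ i → i < 3 → i + (a + q) < a + L
    bound i i<3 = subst (_< a + L) (trans (sym (+-assoc a i q)) (sym (reorder i)))
      (+-monoʳ-< a (<-trans (+-monoˡ-< q (<-≤-trans i<3 3≤q)) (subst (_< L) (cong (q +_) (+-identityʳ q)) 2q<L)))
    shifted : ∀ i → i < 3 → w ! (i + (a + q)) ≡ false
    shifted i i<3 = begin
      w ! (i + (a + q)) ≡⟨ cong (w !_) (reorder i) ⟩
      w ! (a + i + q)   ≡⟨ per (a + i) (m≤m+n a i) (subst (_< a + L) (reorder i) (bound i i<3)) ⟨
      w ! (a + i)       ≡⟨ !-zeros (<-≤-trans (+-monoʳ-< a i<3) a+3≤2+n) ⟩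
      false             ∎
      where open ≡-Reasoning

  periodic-window-in-D : ∀ {a L q} → n ≤ a → a + L ≤ length w → Periodic w a L q →
                         Σ Word λ u → Factor u D × length u ≡ L × HasPeriod u q
  periodic-window-in-D {a} {L} {q} n≤a a+L≤w per =
    u , window-factor D i L , ∣u∣≡L , subst (λ l → Periodic u 0 l q) (sym ∣u∣≡L) (periodic-transfer u w agree per)
    where
    i = a ∸ n
    n+i≡a : n + i ≡ a
    n+i≡a = m+[n∸m]≡n n≤a
    u = window D i L
    ∣u∣≡L : length u ≡ L
    ∣u∣≡L = length-window D i L (+-cancelˡ-≤ n (i + L) (length D)
      (subst₂ _≤_ (trans (cong (_+ L) (sym n+i≡a)) (+-assoc n i L)) length-w a+L≤w))
    agree : ∀ j → j < L → u ! j ≡ w ! (a + j)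
    agree j j<L = trans (!-window D i L j<L)
      (trans (sym (!-D (i + j))) (cong (w !_) (trans (sym (+-assoc n i j)) (cong (_+ j) n+i≡a))))

module TruncatedImage (s t : ℕ) (x y : Word)
                      (μˢ0≡x00y : μ^ s (false ∷ []) ≡ x ++ false ∷ false ∷ y) (∣x∣≡t : length x ≡ t) where
  open Words
  open Periods
  open ThueMorse
  open Desubstitution
  open Fractions
  open import Defs
  open import Data.Bool using (false)
  open import Data.List using ([]; _∷_; _++_; length; replicate; drop)
  open import Data.List.Properties using (++-assoc; length-++; length-replicate; length-drop)
  open import Data.Nat using (ℕ; suc; _+_; _*_; _^_; _∸_; _≤_; _<_; _≤?_; z≤n; s≤s; NonZero; >-nonZero⁻¹)
  open import Data.Nat.Properties
  open import Data.Integer using (+_)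
  open import Data.Rational as ℚ using (_/_)
  import Data.Rational.Properties as ℚₚ
  open import Data.Product using (Σ; _×_; _,_)
  open import Data.Empty using (⊥-elim)
  open import Relation.Nullary using (Dec; yes; no)
  open import Relation.Binary.PropositionalEquality

  instance
    2^s≢0 : NonZero (2 ^ s)
    2^s≢0 = m^n≢0 2 s

  K : Word
  K = false ∷ false ∷ y

  2^s≡t+∣K∣ : 2 ^ s ≡ t + length K
  2^s≡t+∣K∣ = begin
    2 ^ s                      ≡⟨ *-identityʳ (2 ^ s) ⟨
    2 ^ s * 1                  ≡⟨ length-μ^ s (false ∷ []) ⟨
    length (μ^ s (false ∷ [])) ≡⟨ cong length μˢ0≡x00y ⟩
    length (x ++ K)            ≡⟨ length-++ x ⟩
    length x + length K        ≡⟨ cong (_+ length K) ∣x∣≡t ⟩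
    t + length K               ∎
    where open ≡-Reasoning

  t<2^s : t < 2 ^ s
  t<2^s = subst (t <_) (sym 2^s≡t+∣K∣) (m<m+n t (s≤s z≤n))

  μˢ0ʳ≡[xK]ʳ : ∀ r → μ^ s (replicate r false) ≡ repeat r (x ++ K)
  μˢ0ʳ≡[xK]ʳ r = trans (cong (μ^ s) (replicate≡repeat r false))
    (trans (μ^-repeat s r (false ∷ [])) (cong (repeat r) μˢ0≡x00y))

  prefix-power : ∀ {r} → 1 < r → ∀ v →
                 Σ Word λ u → Prefix u (δ^ t (μ^ s (replicate r false ++ v))) × Power u (⟨ r ⟩ ℚ.- t /2^ s)
  prefix-power (s≤s (s≤s {n = n} _)) v =
    repeat (suc n) (K ++ x) ++ K , (μ^ s v , image≡) ,
    length (K ++ x) , false , (false ∷ y) ++ x , K , suc n , s≤s z≤n , (x , refl) , refl , exponent , refl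
    where
    r = suc (suc n)
    image≡ : δ^ t (μ^ s (replicate r false ++ v)) ≡ (repeat (suc n) (K ++ x) ++ K) ++ μ^ s v
    image≡ = begin
      drop t (μ^ s (replicate r false ++ v))                   ≡⟨ cong (drop t) (μ^-++ s (replicate r false) v) ⟩
      drop t (μ^ s (replicate r false) ++ μ^ s v)              ≡⟨ cong (λ z → drop t (z ++ μ^ s v)) (μˢ0ʳ≡[xK]ʳ r) ⟩
      drop t (((x ++ K) ++ repeat (suc n) (x ++ K)) ++ μ^ s v) ≡⟨ cong (drop t) (++-assoc (x ++ K) _ (μ^ s v)) ⟩
      drop t ((x ++ K) ++ repeat (suc n) (x ++ K) ++ μ^ s v)   ≡⟨ cong (drop t) (++-assoc x K _) ⟩
      drop t (x ++ rest)                                       ≡⟨ cong (λ m → drop m (x ++ rest)) ∣x∣≡t ⟨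
      drop (length x) (x ++ rest)                              ≡⟨ drop-length-++ x rest ⟩
      K ++ repeat (suc n) (x ++ K) ++ μ^ s v                   ≡⟨ ++-assoc K _ (μ^ s v) ⟨
      (K ++ repeat (suc n) (x ++ K)) ++ μ^ s v                 ≡⟨ cong (_++ μ^ s v) (repeat-rotate (suc n) K x) ⟩
      (repeat (suc n) (K ++ x) ++ K) ++ μ^ s v                 ∎
      where
      open ≡-Reasoning
      rest = K ++ repeat (suc n) (x ++ K) ++ μ^ s v
    numerator : r * 2 ^ s ∸ t ≡ suc n * 2 ^ s + length K
    numerator = begin
      2 ^ s + suc n * 2 ^ s ∸ t          ≡⟨ cong (λ m → m + suc n * 2 ^ s ∸ t) 2^s≡t+∣K∣ ⟩
      t + length K + suc n * 2 ^ s ∸ t   ≡⟨ cong (_∸ t) (+-assoc t (length K) _) ⟩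
      t + (length K + suc n * 2 ^ s) ∸ t ≡⟨ m+n∸m≡n t _ ⟩
      length K + suc n * 2 ^ s           ≡⟨ +-comm (length K) _ ⟩
      suc n * 2 ^ s + length K           ∎
      where open ≡-Reasoning
    exponent : ⟨ r ⟩ ℚ.- t /2^ s ≡ ⟨ suc n ⟩ ℚ.+ (+ length K) / length (K ++ x)
    exponent = begin
      ⟨ r ⟩ ℚ.- (+ t) / 2 ^ s                 ≡⟨ m-t/d≡[m*d∸t]/d r t (2 ^ s) (≤-trans (<⇒≤ t<2^s) (m≤m+n (2 ^ s) _)) ⟩
      (+ (r * 2 ^ s ∸ t)) / 2 ^ s             ≡⟨ cong (λ m → (+ m) / 2 ^ s) numerator ⟩
      (+ (suc n * 2 ^ s + length K)) / 2 ^ s  ≡⟨ m+k/d≡[m*d+k]/d (suc n) (length K) (2 ^ s) ⟨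
      ⟨ suc n ⟩ ℚ.+ (+ length K) / 2 ^ s      ≡⟨ cong (⟨ suc n ⟩ ℚ.+_) (ℚₚ./-cong {+ length K} refl ∣Kx∣≡2^s) ⟨
      ⟨ suc n ⟩ ℚ.+ (+ length K) / length (K ++ x) ∎
      where
      open ≡-Reasoning
      ∣Kx∣≡2^s : length (K ++ x) ≡ 2 ^ s
      ∣Kx∣≡2^s = trans (length-++ K) (trans (+-comm (length K) (length x)) (trans (cong (_+ length K) ∣x∣≡t) (sym 2^s≡t+∣K∣)))

  power-image : ∀ {r} → 2 < r → ∀ v γ p → ContainsPowerWithPeriod (false ∷ false ∷ v) γ p →
                ContainsPowerWithPeriod (δ^ t (μ^ s (replicate r false ++ v))) γ (2 ^ s * p)
  power-image (s≤s (s≤s (s≤s {n = n} _))) v γ p (u , u⊑D , power) =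
    μ^ s u , subst (Factor (μ^ s u)) (sym image≡) (factor-++ˡ _ (μ^-factor s u⊑D)) , μ^-power s power
    where
    open ZerosThen (suc n) v
    Z = replicate (suc n) false
    t≤∣μˢZ∣ : t ≤ length (μ^ s Z)
    t≤∣μˢZ∣ = subst (t ≤_) (sym (trans (length-μ^ s Z) (cong (2 ^ s *_) (length-replicate (suc n)))))
      (≤-trans (<⇒≤ t<2^s) (m≤m*n (2 ^ s) (suc n)))
    image≡ : δ^ t (μ^ s w) ≡ drop t (μ^ s Z) ++ μ^ s D
    image≡ = trans (cong (λ z → drop t (μ^ s z)) w≡0ⁿD) (trans (cong (drop t) (μ^-++ s Z D)) (drop-++ˡ t _ _ t≤∣μˢZ∣))

  module PowerFreeness (α : LowerReal) (2<α : Below α ⟨ 2 ⟩) (n : ℕ) (v : Word)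
                       (β<α : Below α (⟨ suc (suc n) ⟩ ℚ.- t /2^ s))
                       (D∈𝓛 : InL (false ∷ false ∷ v)) (D-free : PowerFree α (false ∷ false ∷ v)) where
    open ZerosThen n v

    window-in-D-bound : ∀ {a L d} (P : PeriodicPreimage (2 ^ s) w a L (suc d)) →
                        n ≤ PeriodicPreimage.a′ P → Below α ((+ L) / suc d)
    window-in-D-bound {a} {L} {d} P n≤a′ = bound (periodic-window-in-D n≤a′ a′+L′≤∣w∣ periodic)
      where
      open PeriodicPreimage P
      instance _ = preimage-q≢0 P
      bound : (Σ Word λ u → Factor u D × length u ≡ L′ × HasPeriod u q) → Below α ((+ L) / suc d)
      bound (u , u⊑D , ∣u∣≡L′ , u-periodic) = downClosed α
        (m*e≤n*d⇒m/d≤n/e L (length u) (suc d) q (subst (λ l → L * q ≤ l * suc d) (sym ∣u∣≡L′) (preimage-cross P)))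
        (D-free u _ u⊑D (q , periodic⇒power u q q≤∣u∣ u-periodic))
        where
        q≤∣u∣ : q ≤ length u
        q≤∣u∣ = subst (q ≤_) (sym ∣u∣≡L′) (≤-trans (m≤m+n q (q + 0)) (<⇒≤ 2q<L′))

    window-in-zeros-bound : ∀ {a L d} → t ≤ a → (P : PeriodicPreimage (2 ^ s) w a L (suc d)) →
                            let open PeriodicPreimage P in a′ + L′ ≤ suc (suc n) → Below α ((+ L) / suc d)
    window-in-zeros-bound {a} {L} {d} t≤a P a′+L′≤r = downClosed α
      (m*e≤n*d⇒m/d≤n/e L (r * 2 ^ s ∸ t) (suc d) (2 ^ s) (*-mono-≤ L≤r2^s∸t 2^s≤p))
      (subst (Below α) (m-t/d≡[m*d∸t]/d r t (2 ^ s) (≤-trans (<⇒≤ t<2^s) (m≤m+n (2 ^ s) _))) β<α)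
      where
      open PeriodicPreimage P
      instance _ = preimage-q≢0 P
      r = suc (suc n)
      L≤r2^s∸t : L ≤ r * 2 ^ s ∸ t
      L≤r2^s∸t = m+n≤o⇒m≤o∸n L (begin
        L + t               ≤⟨ +-monoʳ-≤ L t≤a ⟩
        L + a               ≡⟨ +-comm L a ⟩
        a + L               ≤⟨ a+L≤k*[a′+L′] ⟩
        2 ^ s * (a′ + L′)   ≤⟨ *-monoʳ-≤ (2 ^ s) a′+L′≤r ⟩
        2 ^ s * r           ≡⟨ *-comm (2 ^ s) r ⟩
        r * 2 ^ s           ∎)
        where open ≤-Reasoning
      2^s≤p : 2 ^ s ≤ suc d
      2^s≤p = subst (2 ^ s ≤_) (sym p≡k*q) (m≤m*n (2 ^ s) q)

    preimage-bound : ∀ {a L d} → t ≤ a → PeriodicPreimage (2 ^ s) w a L (suc d) → Below α ((+ L) / suc d)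
    preimage-bound {a} {L} {d} t≤a P = by-position (n ≤? a′) (a′ + L′ ≤? suc (suc n))
      where
      open PeriodicPreimage P
      by-position : Dec (n ≤ a′) → Dec (a′ + L′ ≤ suc (suc n)) → Below α ((+ L) / suc d)
      by-position (yes n≤a′) _                  = window-in-D-bound P n≤a′
      by-position (no _)     (yes in-zeros)     = window-in-zeros-bound t≤a P in-zeros
      by-position (no n≰a′)  (no out-of-zeros) = ⊥-elim (straddling-window-impossible D∈𝓛 periodic
        (>-nonZero⁻¹ q {{preimage-q≢0 P}}) 2q<L′ (≰⇒> n≰a′) (≰⇒> out-of-zeros) a′+L′≤∣w∣)

    factor-bound : ∀ {u d} → Factor u (δ^ t (μ^ s w)) → HasPeriod u (suc d) → Below α ((+ length u) / suc d)
    factor-bound {u} {d} u⊑δᵗW@(A , B , δᵗW≡AuB) u-periodic with length u ≤? 2 * suc d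
    ... | yes short = downClosed α
      (m*e≤n*d⇒m/d≤n/e (length u) 2 (suc d) 1 (subst (_≤ 2 * suc d) (sym (*-identityʳ (length u))) short)) 2<α
    ... | no  long  = preimage-bound (m≤m+n t (length A)) (μ^-preimage s w fits (≰⇒> long) periodic-in-W)
      where
      W = μ^ s w
      periodic-in-W : Periodic W (t + length A) (length u) (suc d)
      periodic-in-W = periodic-transfer⁻ u W (λ j j<u → trans (!-factor u⊑δᵗW j<u)
        (trans (!-drop t W (length A + j)) (cong (W !_) (sym (+-assoc t (length A) j))))) u-periodic
      t≤∣W∣ : t ≤ length W
      t≤∣W∣ = subst (t ≤_) (sym (length-μ^ s w)) (≤-trans (<⇒≤ t<2^s) (m≤m*n (2 ^ s) (length w)))
      fits : t + length A + length u ≤ 2 ^ s * length w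
      fits = begin
        t + length A + length u              ≡⟨ +-assoc t (length A) (length u) ⟩
        t + (length A + length u)            ≤⟨ +-monoʳ-≤ t (+-monoʳ-≤ (length A) (m≤m+n (length u) (length B))) ⟩
        t + (length A + (length u + length B)) ≡⟨ cong (_+_ t) (trans (length-++ A) (cong (_+_ (length A)) (length-++ u))) ⟨
        t + length (A ++ u ++ B)             ≡⟨ cong (λ z → t + length z) δᵗW≡AuB ⟨
        t + length (drop t W)                ≡⟨ cong (_+_ t) (length-drop t W) ⟩
        t + (length W ∸ t)                   ≡⟨ m+[n∸m]≡n t≤∣W∣ ⟩
        length W                             ≡⟨ length-μ^ s w ⟩
        2 ^ s * length w                     ∎
        where open ≤-Reasoning

    power-free : PowerFree α (δ^ t (μ^ s w))
    power-free u β u⊑δᵗW (p , power@(c , xs , x' , m , _ , _ , refl , refl , refl)) =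
      subst (Below α) (sym (repeat-exponent m c xs x')) (factor-bound u⊑δᵗW (power⇒periodic power))

  power-free : ∀ α → Below α ⟨ 2 ⟩ → ∀ {r} → 1 < r → ∀ v → Below α (⟨ r ⟩ ℚ.- t /2^ s) →
               InL (false ∷ false ∷ v) → PowerFree α (false ∷ false ∷ v) → PowerFree α (δ^ t (μ^ s (replicate r false ++ v)))
  power-free α 2<α (s≤s (s≤s {n = n} _)) v = PowerFreeness.power-free α 2<α n v

open import Defs
open import Data.Bool using (Bool; true; false)
open import Data.List using (List; []; _∷_; _++_; replicate; length)
open import Data.Nat using (ℕ; _≥_; _>_; _^_; _*_)
open import Data.Rational using (ℚ; _<_; _-_)
open import Data.Product using (Σ; _×_)
open import Relation.Binary.PropositionalEquality using (_≡_)

open import Data.Product using (_,_)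
open import Data.Nat.Properties using (<-trans; n<1+n)
open Fractions using (k<m-t/d⇒k<m)

lemma5 : (α : LowerReal) → Below α ⟨ 2 ⟩ → (r : ℕ) → IsCeil α r →
    (s t : ℕ) → s ≥ 3 → t > 0 →
    (Σ Word λ x → Σ Word λ y → μ^ s (false ∷ []) ≡ x ++ false ∷ false ∷ y × length x ≡ t) →
    ⟨ 2 ⟩ < ⟨ r ⟩ - t /2^ s → Below α (⟨ r ⟩ - t /2^ s) →
    (v : Word) → InL (false ∷ false ∷ v) → PowerFree α (false ∷ false ∷ v) →
    (Σ Word λ u → Prefix u (δ^ t (μ^ s (replicate r false ++ v))) × Power u (⟨ r ⟩ - t /2^ s))
    × (∀ (γ : ℚ) (p : ℕ) → p > 0 → ContainsPowerWithPeriod (false ∷ false ∷ v) γ p →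
         ContainsPowerWithPeriod (δ^ t (μ^ s (replicate r false ++ v))) γ (2 ^ s * p))
    × PowerFree α (δ^ t (μ^ s (replicate r false ++ v)))
lemma5 α 2<α r _ s t _ _ (x , y , μˢ0≡x00y , ∣x∣≡t) 2<β β<α v D∈𝓛 D-free =
  prefix-power 1<r v , (λ γ p _ → power-image 2<r v γ p) , power-free α 2<α 1<r v β<α D∈𝓛 D-free
  where
  open TruncatedImage s t x y μˢ0≡x00y ∣x∣≡t
  2<r = k<m-t/d⇒k<m 2 r t (2 ^ s) 2<β
  1<r = <-trans (n<1+n 1) 2<r
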